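{- Let $G_1,\dots,G_d$ be graphs such that, for each $i\in[1,d]$, $G_i$ is $(p_i\!:\!q_i)$-colourable with clustering $c_i$. Then $G_1\boxtimes\cdots\boxtimes G_d$ is $(\prod_i p_i\!:\!\prod_i q_i)$-colourable with clustering $\prod_i c_i$.
   Context: $\boxtimes$ is the strong product (vertex set $V(A)\times V(B)$; distinct $(v,x),(w,y)$ adjacent iff ($v=w$, $xy\in E(B)$) or ($x=y$, $vw\in E(A)$) or ($vw\in E(A)$, $xy\in E(B)$)). A $(p\!:\!q)$-colouring assigns to each vertex a set of $q$ colours from a palette of $p$ colours. For a colour $\alpha$, a monochromatic component is a connected component of the subgraph induced by the vertices whose colour set contains $\alpha$. A colouring has clustering $c$ if every monochromatic component has at most $c$ vertices. -}

module Defs where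

open import Data.Nat using (ℕ; zero; suc; _*_; _≤_)
open import Data.Fin using (Fin; zero; suc)
open import Data.Fin.Subset using (Subset; _∈_; ∣_∣)
open import Data.Product using (Σ; _×_; _,_)
open import Data.Sum using (_⊎_; inj₁; inj₂)
open import Data.Unit using (⊤; tt)
open import Data.Empty using (⊥)
open import Relation.Binary.PropositionalEquality using (_≡_) renaming (sym to ≡-sym)
open import Relation.Binary.Construct.Closure.ReflexiveTransitive using (Star)
open import Function.Definitions using (Injective)

record Graph : Set₁ where
  field
    V     : Set
    E     : V → V → Set
    sym   : ∀ {u v} → E u v → E v u
    irrefl : ∀ {v} → E v v → ⊥
open Graph public

-- Adjacency of the binary strong product, exactly as in the context.
-- (Distinctness of the two pairs is implied by irreflexivity of A and B.)
⊠E : (A B : Graph) → V A × V B → V A × V B → Set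
⊠E A B (v , x) (w , y) =
  (v ≡ w × E B x y) ⊎ ((x ≡ y × E A v w) ⊎ (E A v w × E B x y))

⊠E-sym : (A B : Graph) → ∀ {s t} → ⊠E A B s t → ⊠E A B t s
⊠E-sym A B {v , x} {w , y} (inj₁ (e , b)) = inj₁ (≡-sym e , sym B b)
⊠E-sym A B {v , x} {w , y} (inj₂ (inj₁ (e , a))) = inj₂ (inj₁ (≡-sym e , sym A a))
⊠E-sym A B {v , x} {w , y} (inj₂ (inj₂ (a , b))) = inj₂ (inj₂ (sym A a , sym B b))

⊠E-irrefl : (A B : Graph) → ∀ {s} → ⊠E A B s s → ⊥
⊠E-irrefl A B {v , x} (inj₁ (_ , b)) = irrefl B b
⊠E-irrefl A B {v , x} (inj₂ (inj₁ (_ , a))) = irrefl A a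
⊠E-irrefl A B {v , x} (inj₂ (inj₂ (a , _))) = irrefl A a

_⊠_ : Graph → Graph → Graph
A ⊠ B = record { V = V A × V B ; E = ⊠E A B ; sym = ⊠E-sym A B ; irrefl = ⊠E-irrefl A B }

K₁ : Graph
K₁ = record { V = ⊤ ; E = λ _ _ → ⊥ ; sym = λ () ; irrefl = λ () }

⊠[_] : (d : ℕ) → (Fin d → Graph) → Graph
⊠[ zero ] G = K₁
⊠[ suc d ] G = G zero ⊠ ⊠[ d ] (λ i → G (suc i))

∏[_] : (d : ℕ) → (Fin d → ℕ) → ℕ
∏[ zero ] f = 1
∏[ suc d ] f = f zero * ∏[ d ] (λ i → f (suc i))

record Colouring (G : Graph) (p q : ℕ) : Set where
  field
    col  : V G → Subset p
    size : ∀ v → ∣ col v ∣ ≡ q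
open Colouring public

MonoStep : (G : Graph) {p q : ℕ} → Colouring G p q → Fin p → V G → V G → Set
MonoStep G φ α u w = E G u w × (α ∈ col φ u × α ∈ col φ w)

SameMonoComp : (G : Graph) {p q : ℕ} → Colouring G p q → Fin p → V G → V G → Set
SameMonoComp G φ α = Star (MonoStep G φ α)

-- Clustering c: every monochromatic component has at most c vertices, i.e.
-- any k pairwise distinct vertices of the component satisfy k ≤ c.
HasClustering : (G : Graph) {p q : ℕ} → Colouring G p q → ℕ → Set
HasClustering G φ c =
  ∀ (α : Fin _) (v : V G) → α ∈ col φ v →
  ∀ (k : ℕ) (f : Fin k → V G) → Injective _≡_ _≡_ f →
  (∀ j → SameMonoComp G φ α v (f j)) → k ≤ c

ColourableWithClustering : Graph → ℕ → ℕ → ℕ → Set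
ColourableWithClustering G p q c =
  Σ (Colouring G p q) λ φ → HasClustering G φ c

-- Colour a vertex (v , x) of A ⊠ B with the product of the colour sets of v and x, reading a
-- colour of Fin (p * p′) as the pair (quotient, remainder).  Every edge of A ⊠ B moves each
-- coordinate along an edge or not at all, so a monochromatic walk of colour (α , β) projects to
-- an α-walk in A and a β-walk in B: each monochromatic component of A ⊠ B embeds in the product
-- of two monochromatic components and has at most c · c′ vertices.
module Submission where

open import Defs
open import Data.Bool using (_∧_)
open import Data.Bool.Properties using (∧-conicalˡ; ∧-conicalʳ)
open import Data.Empty using (⊥-elim)
open import Data.Fin using (Fin; zero; suc; quotient; remainder; combine)
open import Data.Fin.Properties using (combine-remQuot)
open import Data.Fin.Subset using (Subset; _∈_; ∣_∣; inside; outside)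
open import Data.Fin.Subset.Properties using (∣⊥∣≡0)
open import Data.List using (List; []; _∷_; length; map; lookup; tabulate)
open import Data.List.Properties using (length-tabulate)
open import Data.List.Membership.Propositional.Properties using (∈-lookup)
open import Data.List.Relation.Binary.Sublist.Propositional using (_⊆_; []; _∷_; _∷ʳ_)
open import Data.List.Relation.Binary.Sublist.Propositional.Properties using (All-resp-⊆)
open import Data.List.Relation.Unary.All as All using (All; []; _∷_)
import Data.List.Relation.Unary.All.Properties as Allₚ
open import Data.List.Relation.Unary.AllPairs using (AllPairs; []; _∷_)
open import Data.List.Relation.Unary.Unique.Propositional using (Unique)
import Data.List.Relation.Unary.Unique.Propositional.Properties as Uniqueₚ
open import Data.Nat using (ℕ; zero; suc; _+_; _*_; _≤_; _≤?_; z≤n; s≤s)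
open import Data.Nat.Properties using (+-suc; +-mono-≤; ≤-pred)
open import Data.Product using (_×_; _,_; proj₁; proj₂)
open import Data.Sum as Sum using (_⊎_; inj₁; inj₂)
open import Data.Vec as Vec using ([]; _∷_; _++_; _⊛*_; replicate)
open import Data.Vec.Properties using ([]=⇒lookup; lookup⇒[]=; lookup-⊛*; lookup-map; map-id; map-const)
open import Function using (_∘_)
open import Function.Definitions using (Injective)
open import Relation.Binary.Construct.Closure.ReflexiveTransitive using (Star; ε; _◅_; kleisliStar)
open import Relation.Binary.PropositionalEquality
  using (_≡_; _≢_; refl; trans; cong; cong₂; subst; module ≡-Reasoning)
  renaming (sym to ≡-sym)
open import Relation.Nullary.Decidable using (Dec; yes; no; decidable-stable; ¬¬-excluded-middle)
open import Relation.Nullary using (Irrelevant)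
open import Relation.Nullary.Negation using (¬_; ¬¬-map)

AtMost : {Z : Set} → (Z → Set) → ℕ → Set
AtMost {Z} S a = ∀ k (f : Fin k → Z) → Injective _≡_ _≡_ f → (∀ j → S (f j)) → k ≤ a

AtMostˡ : {Z : Set} → (Z → Set) → ℕ → Set
AtMostˡ {Z} S a = (zs : List Z) → Unique zs → All S zs → length zs ≤ a

AtMost-⊆ : ∀ {Z : Set} {S T : Z → Set} {a} → (∀ z → S z → T z) → AtMost T a → AtMost S a
AtMost-⊆ S⊆T h k f inj fS = h k f inj (λ j → S⊆T (f j) (fS j))

AllPairs-resp-⊆ : ∀ {Z : Set} {R : Z → Z → Set} {xs ys : List Z} →
                  xs ⊆ ys → AllPairs R ys → AllPairs R xs
AllPairs-resp-⊆ []       []       = []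
AllPairs-resp-⊆ (_ ∷ʳ τ) (_ ∷ ps) = AllPairs-resp-⊆ τ ps
AllPairs-resp-⊆ (refl ∷ τ) (p ∷ ps) = All-resp-⊆ τ p ∷ AllPairs-resp-⊆ τ ps

Unique⇒lookup-injective : ∀ {Z : Set} {zs : List Z} → Unique zs → Injective _≡_ _≡_ (lookup zs)
Unique⇒lookup-injective (_ ∷ _)  {zero}  {zero}  _ = refl
Unique⇒lookup-injective {zs = _ ∷ zs} (z∉ ∷ _) {zero} {suc j} e =
  ⊥-elim (All.lookup z∉ (∈-lookup {xs = zs} j) e)
Unique⇒lookup-injective {zs = _ ∷ zs} (z∉ ∷ _) {suc i} {zero} e =
  ⊥-elim (All.lookup z∉ (∈-lookup {xs = zs} i) (≡-sym e))
Unique⇒lookup-injective (_ ∷ u)  {suc i} {suc j} e = cong suc (Unique⇒lookup-injective u e)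

AtMost⇒AtMostˡ : ∀ {Z : Set} {S : Z → Set} {a} → AtMost S a → AtMostˡ S a
AtMost⇒AtMostˡ h zs u zsS =
  h (length zs) (lookup zs) (Unique⇒lookup-injective u) (λ j → All.lookup zsS (∈-lookup {xs = zs} j))

AtMostˡ⇒AtMost : ∀ {Z : Set} {S : Z → Set} {a} → AtMostˡ S a → AtMost S a
AtMostˡ⇒AtMost {a = a} h k f inj fS =
  subst (_≤ a) (length-tabulate f) (h (tabulate f) (Uniqueₚ.tabulate⁺ inj) (Allₚ.tabulate⁺ fS))

AtMostˡ-zero : ∀ {Z : Set} {S : Z → Set} {z} → AtMostˡ S 0 → ¬ S z
AtMostˡ-zero {z = z} h s with h (z ∷ []) ([] ∷ []) (s ∷ [])
... | ()

AtMostˡ-remove : ∀ {Z : Set} {S : Z → Set} {a z} → AtMostˡ S (suc a) → S z →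
                 AtMostˡ (λ y → S y × z ≢ y) a
AtMostˡ-remove h s zs u zsS =
  ≤-pred (h (_ ∷ zs) (All.map proj₂ zsS ∷ u) (s ∷ All.map proj₁ zsS))

¬¬-All : ∀ {Z : Set} {P : Z → Set} → (∀ z → ¬ ¬ P z) → ∀ zs → ¬ ¬ All P zs
¬¬-All h []       k = k []
¬¬-All h (z ∷ zs) k = h z (λ p → ¬¬-All h zs (λ ps → k (p ∷ ps)))

module _ {X Y : Set} where

  record Fibration (x₀ : X) (zs : List (X × Y)) : Set where
    field
      fibre       : List Y
      rest        : List (X × Y)
      fibre⊆      : map (x₀ ,_) fibre ⊆ zs
      rest⊆       : rest ⊆ zs
      rest-avoids : All (λ w → x₀ ≢ proj₁ w) rest
      length-≡    : length zs ≡ length fibre + length rest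

  fibration : (x₀ : X) (zs : List (X × Y)) → All (λ w → Dec (x₀ ≡ proj₁ w)) zs → Fibration x₀ zs
  fibration x₀ [] [] = record
    { fibre = [] ; rest = [] ; fibre⊆ = [] ; rest⊆ = [] ; rest-avoids = [] ; length-≡ = refl }
  fibration x₀ (z ∷ zs) (yes e ∷ ds) = let open Fibration (fibration x₀ zs ds) in record
    { fibre = proj₂ z ∷ fibre ; rest = rest
    ; fibre⊆ = cong (_, proj₂ z) e ∷ fibre⊆ ; rest⊆ = z ∷ʳ rest⊆
    ; rest-avoids = rest-avoids ; length-≡ = cong suc length-≡ }
  fibration x₀ (z ∷ zs) (no e ∷ ds) = let open Fibration (fibration x₀ zs ds) in record
    { fibre = fibre ; rest = z ∷ rest
    ; fibre⊆ = z ∷ʳ fibre⊆ ; rest⊆ = refl ∷ rest⊆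
    ; rest-avoids = e ∷ rest-avoids
    ; length-≡ = trans (cong suc length-≡) (≡-sym (+-suc (length fibre) (length rest))) }

  -- The vertices carry no decidable equality; but the bound is a decidable proposition, so it
  -- may be proved under ¬ ¬, which supplies the finitely many equality tests that are needed.
  AtMostˡ-× : ∀ {SB : Y → Set} {b} → AtMostˡ SB b → ∀ {SA : X → Set} {a} → AtMostˡ SA a →
              AtMostˡ (λ w → SA (proj₁ w) × SB (proj₂ w)) (a * b)
  AtMostˡ-× hB hA []       _ _ = z≤n
  AtMostˡ-× hB {a = zero} hA (z ∷ zs) _ ((s , _) ∷ _) = ⊥-elim (AtMostˡ-zero hA s)
  AtMostˡ-× {SB} {b} hB {SA} {suc a} hA (z ∷ zs) (z∉ ∷ u) (zS ∷ zsS) =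
    decidable-stable (_ ≤? _) (¬¬-map bound (¬¬-All (λ _ → ¬¬-excluded-middle) zs))
    where
    bound : All (λ w → Dec (proj₁ z ≡ proj₁ w)) zs → suc (length zs) ≤ b + a * b
    bound ds = subst (λ n → suc n ≤ b + a * b) (≡-sym length-≡) (+-mono-≤ fibre-bound rest-bound)
      where
      open Fibration (fibration (proj₁ z) zs ds)
      zFibre⊆ : map (proj₁ z ,_) (proj₂ z ∷ fibre) ⊆ z ∷ zs
      zFibre⊆ = refl ∷ fibre⊆
      fibre-bound : suc (length fibre) ≤ b
      fibre-bound = hB (proj₂ z ∷ fibre)
        (Uniqueₚ.map⁻ (AllPairs-resp-⊆ zFibre⊆ (z∉ ∷ u)))
        (All.map proj₂ (Allₚ.map⁻ (All-resp-⊆ zFibre⊆ (zS ∷ zsS))))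
      rest-bound : length rest ≤ a * b
      rest-bound = AtMostˡ-× hB (AtMostˡ-remove hA (proj₁ zS)) rest
        (AllPairs-resp-⊆ rest⊆ u)
        (All.zipWith (λ { ((sA , sB) , z≢) → (sA , z≢) , sB }) (All-resp-⊆ rest⊆ zsS , rest-avoids))

  AtMost-× : ∀ {SA : X → Set} {SB : Y → Set} {a b} → AtMost SA a → AtMost SB b →
             AtMost (λ w → SA (proj₁ w) × SB (proj₂ w)) (a * b)
  AtMost-× {SA} {SB} hA hB =
    AtMostˡ⇒AtMost (AtMostˡ-× (AtMost⇒AtMostˡ {S = SB} hB) (AtMost⇒AtMostˡ {S = SA} hA))

_⊗_ : ∀ {m n} → Subset m → Subset n → Subset (m * n)
A ⊗ B = Vec.map _∧_ A ⊛* B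

∣++∣ : ∀ {m n} (A : Subset m) (B : Subset n) → ∣ A ++ B ∣ ≡ ∣ A ∣ + ∣ B ∣
∣++∣ []            B = refl
∣++∣ (inside ∷ A)  B = cong suc (∣++∣ A B)
∣++∣ (outside ∷ A) B = ∣++∣ A B

∣⊗∣ : ∀ {m n} (A : Subset m) (B : Subset n) → ∣ A ⊗ B ∣ ≡ ∣ A ∣ * ∣ B ∣
∣⊗∣ [] B = refl
∣⊗∣ (inside ∷ A) B = begin
  ∣ Vec.map (inside ∧_) B ++ A ⊗ B ∣  ≡⟨ ∣++∣ (Vec.map (inside ∧_) B) (A ⊗ B) ⟩
  ∣ Vec.map (inside ∧_) B ∣ + ∣ A ⊗ B ∣ ≡⟨ cong₂ _+_ (cong ∣_∣ (map-id B)) (∣⊗∣ A B) ⟩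
  ∣ B ∣ + ∣ A ∣ * ∣ B ∣               ∎
  where open ≡-Reasoning
∣⊗∣ {n = n} (outside ∷ A) B = begin
  ∣ Vec.map (outside ∧_) B ++ A ⊗ B ∣  ≡⟨ ∣++∣ (Vec.map (outside ∧_) B) (A ⊗ B) ⟩
  ∣ Vec.map (outside ∧_) B ∣ + ∣ A ⊗ B ∣ ≡⟨ cong₂ _+_ (cong ∣_∣ (map-const B outside)) (∣⊗∣ A B) ⟩
  ∣ replicate n outside ∣ + ∣ A ∣ * ∣ B ∣ ≡⟨ cong (_+ ∣ A ∣ * ∣ B ∣) (∣⊥∣≡0 n) ⟩
  ∣ A ∣ * ∣ B ∣                        ∎
  where open ≡-Reasoning

∈⊗⇒ : ∀ {m n} {A : Subset m} {B : Subset n} {γ} → γ ∈ A ⊗ B →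
      quotient n γ ∈ A × remainder {m} n γ ∈ B
∈⊗⇒ {m} {n} {A} {B} {γ} γ∈ =
    lookup⇒[]= i A (∧-conicalˡ (Vec.lookup A i) (Vec.lookup B j) A∧B)
  , lookup⇒[]= j B (∧-conicalʳ (Vec.lookup A i) (Vec.lookup B j) A∧B)
  where
  open ≡-Reasoning
  i = quotient n γ
  j = remainder {m} n γ
  A∧B : Vec.lookup A i ∧ Vec.lookup B j ≡ inside
  A∧B = begin
    Vec.lookup A i ∧ Vec.lookup B j             ≡⟨ cong (λ f → f (Vec.lookup B j)) (lookup-map i _∧_ A) ⟨
    Vec.lookup (Vec.map _∧_ A) i (Vec.lookup B j) ≡⟨ lookup-⊛* (Vec.map _∧_ A) B i j ⟨
    Vec.lookup (A ⊗ B) (combine i j)            ≡⟨ cong (Vec.lookup (A ⊗ B)) (combine-remQuot {m} n γ) ⟩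
    Vec.lookup (A ⊗ B) γ                        ≡⟨ []=⇒lookup γ∈ ⟩
    inside                                      ∎

AtMost-irrelevant : ∀ {Z : Set} {S : Z → Set} → Irrelevant Z → AtMost S 1
AtMost-irrelevant _ zero          _ _   _ = z≤n
AtMost-irrelevant _ (suc zero)    _ _   _ = s≤s z≤n
AtMost-irrelevant z≡ (suc (suc k)) f inj _ with inj {zero} {suc zero} (z≡ _ _)
... | ()

≡⊎⇒Star : ∀ {I : Set} {R : I → I → Set} {x y} → x ≡ y ⊎ R x y → Star R x y
≡⊎⇒Star (inj₁ refl) = ε
≡⊎⇒Star (inj₂ r)    = r ◅ ε

module _ {A B : Graph} where

  ⊠-adjˡ : ∀ {s t} → E (A ⊠ B) s t → proj₁ s ≡ proj₁ t ⊎ E A (proj₁ s) (proj₁ t)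
  ⊠-adjˡ (inj₁ (v≡w , _))        = inj₁ v≡w
  ⊠-adjˡ (inj₂ (inj₁ (_ , vw)))  = inj₂ vw
  ⊠-adjˡ (inj₂ (inj₂ (vw , _)))  = inj₂ vw

  ⊠-adjʳ : ∀ {s t} → E (A ⊠ B) s t → proj₂ s ≡ proj₂ t ⊎ E B (proj₂ s) (proj₂ t)
  ⊠-adjʳ (inj₁ (_ , xy))         = inj₂ xy
  ⊠-adjʳ (inj₂ (inj₁ (x≡y , _))) = inj₁ x≡y
  ⊠-adjʳ (inj₂ (inj₂ (_ , xy)))  = inj₂ xy

  module _ {p q} {χ : Colouring (A ⊠ B) p q} {γ : Fin p} where

    SameMonoComp-proj₁ : ∀ {pA qA} {φ : Colouring A pA qA} {α} →
                         (∀ {s} → γ ∈ col χ s → α ∈ col φ (proj₁ s)) →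
                         ∀ {s t} → SameMonoComp (A ⊠ B) χ γ s t → SameMonoComp A φ α (proj₁ s) (proj₁ t)
    SameMonoComp-proj₁ χ⇒φ = kleisliStar proj₁ λ (st , γ∈s , γ∈t) →
      ≡⊎⇒Star (Sum.map₂ (λ vw → vw , χ⇒φ γ∈s , χ⇒φ γ∈t) (⊠-adjˡ st))

    SameMonoComp-proj₂ : ∀ {pB qB} {ψ : Colouring B pB qB} {β} →
                         (∀ {s} → γ ∈ col χ s → β ∈ col ψ (proj₂ s)) →
                         ∀ {s t} → SameMonoComp (A ⊠ B) χ γ s t → SameMonoComp B ψ β (proj₂ s) (proj₂ t)
    SameMonoComp-proj₂ χ⇒ψ = kleisliStar proj₂ λ (st , γ∈s , γ∈t) →
      ≡⊎⇒Star (Sum.map₂ (λ xy → xy , χ⇒ψ γ∈s , χ⇒ψ γ∈t) (⊠-adjʳ st))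

  _⊠ᶜ_ : ∀ {p q p′ q′} → Colouring A p q → Colouring B p′ q′ → Colouring (A ⊠ B) (p * p′) (q * q′)
  φ ⊠ᶜ ψ = record
    { col  = λ (v , x) → col φ v ⊗ col ψ x
    ; size = λ (v , x) → trans (∣⊗∣ (col φ v) (col ψ x)) (cong₂ _*_ (size φ v) (size ψ x))
    }

  ⊠-hasClustering : ∀ {p q p′ q′ c c′} {φ : Colouring A p q} {ψ : Colouring B p′ q′} →
                    HasClustering A φ c → HasClustering B ψ c′ → HasClustering (A ⊠ B) (φ ⊠ᶜ ψ) (c * c′)
  ⊠-hasClustering {p = p} {p′ = p′} {φ = φ} {ψ = ψ} hA hB γ (v , x) γ∈ =
    AtMost-⊆ project (AtMost-× {SA = SameMonoComp A φ α v} {SB = SameMonoComp B ψ β x}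
                                (hA α v (γ⇒α γ∈)) (hB β x (γ⇒β γ∈)))
    where
    α : Fin p
    α = quotient p′ γ
    β : Fin p′
    β = remainder {p} p′ γ
    γ⇒α : ∀ {s} → γ ∈ col (φ ⊠ᶜ ψ) s → α ∈ col φ (proj₁ s)
    γ⇒α {s} = proj₁ ∘ ∈⊗⇒ {A = col φ (proj₁ s)}
    γ⇒β : ∀ {s} → γ ∈ col (φ ⊠ᶜ ψ) s → β ∈ col ψ (proj₂ s)
    γ⇒β {s} = proj₂ ∘ ∈⊗⇒ {A = col φ (proj₁ s)}
    project : ∀ t → SameMonoComp (A ⊠ B) (φ ⊠ᶜ ψ) γ (v , x) t →
              SameMonoComp A φ α v (proj₁ t) × SameMonoComp B ψ β x (proj₂ t)
    project t walk = SameMonoComp-proj₁ {χ = φ ⊠ᶜ ψ} {φ = φ} γ⇒α walk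
                   , SameMonoComp-proj₂ {χ = φ ⊠ᶜ ψ} {ψ = ψ} γ⇒β walk

  ⊠-colourableWithClustering : ∀ {p q c p′ q′ c′} →
    ColourableWithClustering A p q c → ColourableWithClustering B p′ q′ c′ →
    ColourableWithClustering (A ⊠ B) (p * p′) (q * q′) (c * c′)
  ⊠-colourableWithClustering (φ , hA) (ψ , hB) = φ ⊠ᶜ ψ , ⊠-hasClustering {φ = φ} {ψ = ψ} hA hB

K₁-colourableWithClustering : ColourableWithClustering K₁ 1 1 1
K₁-colourableWithClustering = χ , λ α v _ → AtMost-irrelevant {S = SameMonoComp K₁ χ α v} (λ _ _ → refl)
  where
  χ : Colouring K₁ 1 1
  χ = record { col = λ _ → inside ∷ [] ; size = λ _ → refl }

mainTheorem4 : (d : ℕ) (G : Fin d → Graph) (p q c : Fin d → ℕ) →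
    (∀ i → ColourableWithClustering (G i) (p i) (q i) (c i)) →
    ColourableWithClustering (⊠[ d ] G) (∏[ d ] p) (∏[ d ] q) (∏[ d ] c)
mainTheorem4 zero    G p q c h = K₁-colourableWithClustering
mainTheorem4 (suc d) G p q c h =
  ⊠-colourableWithClustering (h zero) (mainTheorem4 d (G ∘ suc) (p ∘ suc) (q ∘ suc) (c ∘ suc) (h ∘ suc))
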